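{- Let $(P,A_1,\ldots,A_n)$ be a regular poset of width $w$, $P=(V,\le_P)$, and let $r,s\in[n]$ with $A_r\sqsubset_P A_s$. Then: (a) the bipartite subposet $P[A_r\cup A_s]$ is a core; (b) if $t\in[n]$ satisfies $A_r\sqsubseteq_P A_t\sqsubseteq_P A_s$ and either $t=\min\{k\in[n]: A_t\sqsubseteq_P A_k\sqsubseteq_P A_s\}$ or $t=\min\{k\in[n]: A_r\sqsubseteq_P A_k\sqsubseteq_P A_t\}$, then for any $x\in A_r$ and $y\in A_s$ with $x\le_P y$ there is $z\in A_t$ with $x\le_P z\le_P y$.
   Context: For a poset $P$ and $B\subseteq P$, $D_P[B]$ is the set of elements that are $\le_P$ some element of $B$. A maximum antichain is an antichain of size equal to the width of $P$. For maximum antichains $A,B$ write $A\sqsubseteq_P B$ if $A\subseteq D_P[B]$, and $A\sqsubset_P B$ if moreover $A\ne B$. A bipartite poset with disjoint antichains $A,B$, $A\sqsubset B$, is a core if $|A|=|B|$ and for every comparable pair $x\le y$ with $x\in A$, $y\in B$ there is a partition of $A\cup B$ into $|A|$ chains in which $x$ and $y$ lie in the same chain. A tuple $(P,A_1,\dots,A_n)$ is a regular poset of width $w$ if $P=(V,\le_P)$ is a finite poset of width $w$ and $A_1,\dots,A_n$ are maximum antichains of $P$ such that: (R1) $V=A_1\cup\dots\cup A_n$; (R2) $A_i\cap A_j=\emptyset$ for $i\ne j$; (R3) $\{A_1,\dots,A_n\}$ is linearly ordered by $\sqsubseteq_P$; for each $i$, let $A_{p(i)}$ be the $\sqsubseteq_P$-greatest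 among $A_1,\dots,A_{i-1}$ with $A_{p(i)}\sqsubset_P A_i$ and $A_{s(i)}$ the $\sqsubseteq_P$-least among $A_1,\dots,A_{i-1}$ with $A_i\sqsubset_P A_{s(i)}$ (each undefined if no such antichain exists); (R4) $P[A_i\cup A_{s(i)}]$ is a core whenever $s(i)$ is defined and $P[A_{p(i)}\cup A_i]$ is a core whenever $p(i)$ is defined; (R5) if $x<_P y$ with $x\in A_i$, $y\in A_j$, then if $i>j$ there is $z\in A_{s(i)}$ with $x<_P z\le_P y$, and otherwise there is $z\in A_{p(j)}$ with $x\le_P z<_P y$. -}

module Defs where

open import Level using (0ℓ)
open import Data.Nat using (ℕ; _≤_; _<_)
open import Data.Fin using (Fin; toℕ)
open import Data.Fin.Subset using (Subset; _∈_; ∣_∣)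
open import Data.Product using (Σ; ∃; _×_; _,_)
open import Data.Sum using (_⊎_)
open import Data.Empty using (⊥)
open import Relation.Nullary using (¬_)
open import Relation.Binary using (Rel)
open import Relation.Binary.PropositionalEquality using (_≡_; _≢_)

-- A finite poset on the carrier Fin m is given by a relation _≼_ which is
-- assumed (in the statement) to be a partial order w.r.t. _≡_.

module _ {m : ℕ} (_≼_ : Rel (Fin m) 0ℓ) where

  _≺_ : Fin m → Fin m → Set
  x ≺ y = (x ≼ y) × (x ≢ y)

  IsAntichain : Subset m → Set
  IsAntichain A = ∀ x y → x ∈ A → y ∈ A → x ≼ y → x ≡ y

  HasWidth : ℕ → Set
  HasWidth w = (Σ (Subset m) λ A → IsAntichain A × ∣ A ∣ ≡ w)
             × (∀ A → IsAntichain A → ∣ A ∣ ≤ w)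

  IsMaxAntichain : ℕ → Subset m → Set
  IsMaxAntichain w A = IsAntichain A × ∣ A ∣ ≡ w

  InDown : Subset m → Fin m → Set
  InDown B x = Σ (Fin m) λ y → y ∈ B × x ≼ y

  _⊑_ : Subset m → Subset m → Set
  A ⊑ B = ∀ x → x ∈ A → InDown B x

  _⊏_ : Subset m → Subset m → Set
  A ⊏ B = (A ⊑ B) × (A ≢ B)

  InUnion : Subset m → Subset m → Fin m → Set
  InUnion A B x = (x ∈ A) ⊎ (x ∈ B)

  -- c is a partition of the set S = {x | S x} into exactly k chains
  -- (block i = {x ∈ S | c x ≡ i}); every block is nonempty and is a chain.
  IsChainPartition : (Fin m → Set) → (k : ℕ) → (Fin m → Fin k) → Set
  IsChainPartition S k c =
      (∀ i → Σ (Fin m) λ x → S x × c x ≡ i)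
    × (∀ x y → S x → S y → c x ≡ c y → (x ≼ y) ⊎ (y ≼ x))

  -- The bipartite subposet P[A ∪ B] (with A ⊏ B) is a core.
  -- The order of P[A ∪ B] is the restriction of _≼_, so all notions below
  -- are taken with respect to _≼_ restricted to A ∪ B.
  IsCore : Subset m → Subset m → Set
  IsCore A B =
      IsAntichain A × IsAntichain B
    × (∀ x → x ∈ A → x ∈ B → ⊥)
    × (A ⊏ B)
    × (∣ A ∣ ≡ ∣ B ∣)
    × (∀ x y → x ∈ A → y ∈ B → x ≼ y →
         Σ (Fin m → Fin ∣ A ∣) λ c →
           IsChainPartition (InUnion A B) ∣ A ∣ c × c x ≡ c y)

  module _ {n : ℕ} (A : Fin n → Subset m) where

    IsPred : Fin n → Fin n → Set
    IsPred i j = (toℕ j < toℕ i) × (A j ⊏ A i)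
               × (∀ k → toℕ k < toℕ i → A k ⊏ A i → A k ⊑ A j)

    IsSucc : Fin n → Fin n → Set
    IsSucc i j = (toℕ j < toℕ i) × (A i ⊏ A j)
               × (∀ k → toℕ k < toℕ i → A i ⊏ A k → A j ⊑ A k)

    IsRegular : ℕ → Set
    IsRegular w =
        HasWidth w
      × (∀ i → IsMaxAntichain w (A i))
      × (∀ x → Σ (Fin n) λ i → x ∈ A i)
      × (∀ i j → i ≢ j → ∀ x → x ∈ A i → x ∈ A j → ⊥)
      × (∀ i j → (A i ⊑ A j) ⊎ (A j ⊑ A i))
      × (∀ i j → IsSucc i j → IsCore (A i) (A j))
      × (∀ i j → IsPred i j → IsCore (A j) (A i))
      × (∀ i j x y → x ∈ A i → y ∈ A j → x ≺ y →
           (toℕ j < toℕ i →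
              Σ (Fin n) λ k → IsSucc i k ×
                Σ (Fin m) λ z → z ∈ A k × (x ≺ z) × (z ≼ y))
         × (toℕ i ≤ toℕ j →
              Σ (Fin n) λ k → IsPred j k ×
                Σ (Fin m) λ z → z ∈ A k × (x ≼ z) × (z ≺ y)))

-- If X ∪ Y and Y ∪ Z (Y, Z maximum antichains, X ⊑ Y ⊑ Z) are partitioned
-- into w chains, each chain of the first partition meets Y in exactly one
-- element, so following it through that element into a chain of the second
-- partition yields a partition of X ∪ Z into w chains. For x ≤ y with
-- x ∈ A_i and y ∈ A_j, axiom (R5) supplies z in some A_k between them, where
-- k is smaller than i or than j and one of the two halves is a core by (R4).
-- Induction on the sum of the indices therefore shows that P[A_r ∪ A_s] is a
-- core and, when t is extremal, finds the element of A_t between x and y.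
module Submission where

open import Defs
open import Level using (0ℓ)
open import Data.Nat using (ℕ; _≤_)
open import Data.Fin using (Fin; toℕ)
open import Data.Fin.Subset using (Subset; _∈_)
open import Data.Product using (Σ; _×_)
open import Data.Sum using (_⊎_)
open import Relation.Binary using (Rel; IsPartialOrder)
open import Relation.Binary.PropositionalEquality using (_≡_)

open import Data.Nat using (_<_; _+_; _⊔_; z≤n)
open import Data.Nat.Properties
  using (≤-<-trans; <-irrefl; <⇒≤; ≤∧≢⇒<; ≮⇒≥; _<?_; +-monoˡ-<; +-monoʳ-<;
         m≤n⇒m≤n⊔o; m≤n⇒m≤o⊔n; m≥n⇒m⊔n≡m; m≤n⇒m⊔n≡n)
open import Data.Nat.Induction using (<-wellFounded)
open import Data.Fin using (zero; suc)
open import Data.Fin.Properties using (any?; suc-injective; toℕ-injective; _≟_)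
open import Data.Fin.Subset using (⊤; _-_; ∣_∣; _∉_; inside; outside)
open import Data.Fin.Subset.Properties using (_∈?_; ∈⊤; ∣⊤∣≡n; x∈p∧x≢y⇒x∈p-y; x∈p⇒∣p-x∣<∣p∣)
open import Data.Vec using ([]; _∷_; here; there)
open import Data.Product using (∃; _,_; proj₁; proj₂)
open import Data.Sum using (inj₁; inj₂)
open import Data.Empty using (⊥; ⊥-elim)
open import Function using (_∘_)
open import Induction.WellFounded using (Acc; acc)
open import Relation.Binary using (IsPreorder)
open import Relation.Nullary using (yes; no; contradiction)
open import Relation.Nullary.Decidable using (_×-dec_)
open import Relation.Binary.PropositionalEquality using (refl; sym; trans; cong; subst; _≢_; module ≡-Reasoning)

InjectiveOn : ∀ {m k} → Subset m → (Fin m → Fin k) → Set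
InjectiveOn p f = ∀ {x y} → x ∈ p → y ∈ p → f x ≡ f y → x ≡ y

injectiveOn⇒∣p∣≤∣q∣ : ∀ {m k} (p : Subset m) (q : Subset k) (f : Fin m → Fin k) →
  (∀ {x} → x ∈ p → f x ∈ q) → InjectiveOn p f → ∣ p ∣ ≤ ∣ q ∣
injectiveOn⇒∣p∣≤∣q∣ []            q f maps inj = z≤n
injectiveOn⇒∣p∣≤∣q∣ (outside ∷ p) q f maps inj =
  injectiveOn⇒∣p∣≤∣q∣ p q (f ∘ suc) (maps ∘ there)
    (λ x∈p y∈p → suc-injective ∘ inj (there x∈p) (there y∈p))
injectiveOn⇒∣p∣≤∣q∣ (inside ∷ p) q f maps inj =
  ≤-<-trans
    (injectiveOn⇒∣p∣≤∣q∣ p (q - f zero) (f ∘ suc)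
      (λ x∈p → x∈p∧x≢y⇒x∈p-y (maps (there x∈p)) (λ e → suc≢zero (inj (there x∈p) here e)))
      (λ x∈p y∈p → suc-injective ∘ inj (there x∈p) (there y∈p)))
    (x∈p⇒∣p-x∣<∣p∣ (maps here))
  where
  suc≢zero : ∀ {m} {x : Fin m} → suc x ≢ zero
  suc≢zero ()

injectiveOn⇒onto : ∀ {m k} {p : Subset m} {f : Fin m → Fin k} → ∣ p ∣ ≡ k → InjectiveOn p f →
  ∀ i → ∃ λ x → x ∈ p × f x ≡ i
injectiveOn⇒onto {m} {k} {p} {f} ∣p∣≡k inj i with any? (λ x → (x ∈? p) ×-dec (f x ≟ i))
... | yes hit = hit
... | no miss = ⊥-elim (<-irrefl ∣p∣≡∣⊤∣ (≤-<-trans p↪⊤-i (x∈p⇒∣p-x∣<∣p∣ {p = ⊤} (∈⊤ {x = i}))))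
  where
  p↪⊤-i : ∣ p ∣ ≤ ∣ ⊤ - i ∣
  p↪⊤-i = injectiveOn⇒∣p∣≤∣q∣ p (⊤ - i) f
    (λ x∈p → x∈p∧x≢y⇒x∈p-y ∈⊤ (λ e → miss (_ , x∈p , e))) inj
  ∣p∣≡∣⊤∣ : ∣ p ∣ ≡ ∣ ⊤ {k} ∣
  ∣p∣≡∣⊤∣ = trans ∣p∣≡k (sym (∣⊤∣≡n k))

module Chains {m : ℕ} {_≼_ : Rel (Fin m) 0ℓ} (≼-isPreorder : IsPreorder _≡_ _≼_) where

  open IsPreorder ≼-isPreorder using () renaming (refl to ≼-refl; trans to ≼-trans)
  open ≡-Reasoning

  Comparable : Fin m → Fin m → Set
  Comparable x y = (x ≼ y) ⊎ (y ≼ x)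

  Linked : Subset m → Subset m → ℕ → Fin m → Fin m → Set
  Linked X Y k x y = Σ (Fin m → Fin k) λ c →
    IsChainPartition _≼_ (InUnion _≼_ X Y) k c × c x ≡ c y

  core⇒linked : ∀ {X Y x y} → IsCore _≼_ X Y → x ∈ X → y ∈ Y → x ≼ y → Linked X Y ∣ X ∣ x y
  core⇒linked (_ , _ , _ , _ , _ , linked) = linked _ _

  ⊑-refl : ∀ {X} → _⊑_ _≼_ X X
  ⊑-refl x x∈X = x , x∈X , ≼-refl

  ⊑-trans : ∀ {X Y Z} → _⊑_ _≼_ X Y → _⊑_ _≼_ Y Z → _⊑_ _≼_ X Z
  ⊑-trans X⊑Y Y⊑Z x x∈X with X⊑Y x x∈X
  ... | y , y∈Y , x≼y with Y⊑Z y y∈Y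
  ... | z , z∈Z , y≼z = z , z∈Z , ≼-trans x≼y y≼z

  antichain-comparable⇒≡ : ∀ {X x y} → IsAntichain _≼_ X → x ∈ X → y ∈ X → Comparable x y → x ≡ y
  antichain-comparable⇒≡ antiX x∈X y∈X (inj₁ x≼y) = antiX _ _ x∈X y∈X x≼y
  antichain-comparable⇒≡ antiX x∈X y∈X (inj₂ y≼x) = sym (antiX _ _ y∈X x∈X y≼x)

  ⊑-comparable⇒≼ : ∀ {X Y x y} → IsAntichain _≼_ Y → _⊑_ _≼_ X Y → x ∈ X → y ∈ Y →
    Comparable x y → x ≼ y
  ⊑-comparable⇒≼ antiY X⊑Y x∈X y∈Y (inj₁ x≼y) = x≼y
  ⊑-comparable⇒≼ antiY X⊑Y x∈X y∈Y (inj₂ y≼x) with X⊑Y _ x∈X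
  ... | y′ , y′∈Y , x≼y′ =
    subst (_ ≼_) (sym (antiY _ _ y∈Y y′∈Y (≼-trans y≼x x≼y′))) x≼y′

  ⊑-through : ∀ {X Y Z x} → IsAntichain _≼_ Z → _⊑_ _≼_ X Y → _⊑_ _≼_ Y Z → x ∈ X → x ∈ Z →
    ∃ λ z → z ∈ Y × x ≼ z × z ≼ x
  ⊑-through antiZ X⊑Y Y⊑Z x∈X x∈Z with X⊑Y _ x∈X
  ... | z , z∈Y , x≼z = z , z∈Y , x≼z , ⊑-comparable⇒≼ antiZ Y⊑Z z∈Y x∈Z (inj₂ x≼z)

  linked-trans : ∀ {k X Y Z x y z} → IsAntichain _≼_ Y → IsAntichain _≼_ Z →
    ∣ Y ∣ ≡ k → ∣ Z ∣ ≡ k → _⊑_ _≼_ X Y → _⊑_ _≼_ Y Z → (∀ u → u ∈ X → u ∈ Z → ⊥) →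
    x ∈ X → y ∈ Y → z ∈ Z → Linked X Y k x y → Linked Y Z k y z → Linked X Z k x z
  linked-trans {k} {X} {Y} {Z} {x} {y} {z} antiY antiZ ∣Y∣≡k ∣Z∣≡k X⊑Y Y⊑Z X∩Z=∅ x∈X y∈Y z∈Z
               (c₁ , (_ , chain₁) , c₁x≡c₁y) (c₂ , (_ , chain₂) , c₂y≡c₂z) =
    c₂ ∘ lift , (blocks , chain) , c₂-lift-x≡c₂-lift-z
    where
    representative : ∀ i → ∃ λ b → b ∈ Y × c₁ b ≡ i
    representative = injectiveOn⇒onto ∣Y∣≡k λ b∈Y b′∈Y →
      antichain-comparable⇒≡ antiY b∈Y b′∈Y ∘ chain₁ _ _ (inj₂ b∈Y) (inj₂ b′∈Y)

    rep : Fin k → Fin m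
    rep i = proj₁ (representative i)

    rep∈Y : ∀ i → rep i ∈ Y
    rep∈Y i = proj₁ (proj₂ (representative i))

    c₁-rep : ∀ i → c₁ (rep i) ≡ i
    c₁-rep i = proj₂ (proj₂ (representative i))

    lift : Fin m → Fin m
    lift u with u ∈? X
    ... | yes _ = rep (c₁ u)
    ... | no  _ = u

    lift-∈ : ∀ {u} → u ∈ X → lift u ≡ rep (c₁ u)
    lift-∈ {u} u∈X with u ∈? X
    ... | yes _   = refl
    ... | no  u∉X = contradiction u∈X u∉X

    lift-∉ : ∀ {u} → u ∉ X → lift u ≡ u
    lift-∉ {u} u∉X with u ∈? X
    ... | yes u∈X = contradiction u∈X u∉X
    ... | no  _   = refl

    ≼rep : ∀ {u} → u ∈ X → u ≼ rep (c₁ u)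
    ≼rep u∈X = ⊑-comparable⇒≼ antiY X⊑Y u∈X (rep∈Y _)
      (chain₁ _ _ (inj₁ u∈X) (inj₂ (rep∈Y _)) (sym (c₁-rep _)))

    ∉X⇒∈Z : ∀ {u} → InUnion _≼_ X Z u → u ∉ X → u ∈ Z
    ∉X⇒∈Z (inj₁ u∈X) u∉X = contradiction u∈X u∉X
    ∉X⇒∈Z (inj₂ u∈Z) _   = u∈Z

    cross : ∀ {u v} → u ∈ X → v ∈ Z → c₂ (rep (c₁ u)) ≡ c₂ v → u ≼ v
    cross u∈X v∈Z e = ≼-trans (≼rep u∈X)
      (⊑-comparable⇒≼ antiZ Y⊑Z (rep∈Y _) v∈Z (chain₂ _ _ (inj₁ (rep∈Y _)) (inj₂ v∈Z) e))

    chain : ∀ u v → InUnion _≼_ X Z u → InUnion _≼_ X Z v → c₂ (lift u) ≡ c₂ (lift v) →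
      Comparable u v
    chain u v u∈X∪Z v∈X∪Z e with u ∈? X | v ∈? X
    ... | yes u∈X | yes v∈X = chain₁ u v (inj₁ u∈X) (inj₁ v∈X) (begin
          c₁ u               ≡⟨ sym (c₁-rep _) ⟩
          c₁ (rep (c₁ u))    ≡⟨ cong c₁ (antichain-comparable⇒≡ antiY (rep∈Y _) (rep∈Y _)
                                  (chain₂ _ _ (inj₁ (rep∈Y _)) (inj₁ (rep∈Y _)) e)) ⟩
          c₁ (rep (c₁ v))    ≡⟨ c₁-rep _ ⟩
          c₁ v               ∎)
    ... | yes u∈X | no v∉X  = inj₁ (cross u∈X (∉X⇒∈Z v∈X∪Z v∉X) e)
    ... | no u∉X  | yes v∈X = inj₂ (cross v∈X (∉X⇒∈Z u∈X∪Z u∉X) (sym e))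
    ... | no u∉X  | no v∉X  = chain₂ u v (inj₂ (∉X⇒∈Z u∈X∪Z u∉X)) (inj₂ (∉X⇒∈Z v∈X∪Z v∉X)) e

    c₂-onto-Z : ∀ i → ∃ λ u → u ∈ Z × c₂ u ≡ i
    c₂-onto-Z = injectiveOn⇒onto ∣Z∣≡k λ u∈Z v∈Z →
      antichain-comparable⇒≡ antiZ u∈Z v∈Z ∘ chain₂ _ _ (inj₂ u∈Z) (inj₂ v∈Z)

    blocks : ∀ i → ∃ λ u → InUnion _≼_ X Z u × c₂ (lift u) ≡ i
    blocks i with c₂-onto-Z i
    ... | u , u∈Z , c₂u≡i = u , inj₂ u∈Z , trans (cong c₂ (lift-∉ (λ u∈X → X∩Z=∅ u u∈X u∈Z))) c₂u≡i

    rep-x≡y : rep (c₁ x) ≡ y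
    rep-x≡y = antichain-comparable⇒≡ antiY (rep∈Y _) y∈Y
      (chain₁ _ _ (inj₂ (rep∈Y _)) (inj₂ y∈Y) (trans (c₁-rep _) c₁x≡c₁y))

    c₂-lift-x≡c₂-lift-z : c₂ (lift x) ≡ c₂ (lift z)
    c₂-lift-x≡c₂-lift-z = begin
      c₂ (lift x)          ≡⟨ cong c₂ (trans (lift-∈ x∈X) rep-x≡y) ⟩
      c₂ y                 ≡⟨ c₂y≡c₂z ⟩
      c₂ z                 ≡⟨ cong c₂ (sym (lift-∉ (λ z∈X → X∩Z=∅ z z∈X z∈Z))) ⟩
      c₂ (lift z)          ∎

module RegularPoset {m n w : ℕ} {_≼_ : Rel (Fin m) 0ℓ} (≼-isPreorder : IsPreorder _≡_ _≼_)
                    {A : Fin n → Subset m} (regular : IsRegular _≼_ A w) where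

  open Chains ≼-isPreorder
  open IsPreorder ≼-isPreorder using () renaming (refl to ≼-refl; trans to ≼-trans)

  maximum : ∀ i → IsMaxAntichain _≼_ w (A i)
  maximum = proj₁ (proj₂ regular)

  antichain : ∀ i → IsAntichain _≼_ (A i)
  antichain = proj₁ ∘ maximum

  size : ∀ i → ∣ A i ∣ ≡ w
  size = proj₂ ∘ maximum

  disjoint : ∀ {i j x} → i ≢ j → x ∈ A i → x ∈ A j → ⊥
  disjoint i≢j = proj₁ (proj₂ (proj₂ (proj₂ regular))) _ _ i≢j _

  succ-core : ∀ {i j} → IsSucc _≼_ A i j → IsCore _≼_ (A i) (A j)
  succ-core = proj₁ (proj₂ (proj₂ (proj₂ (proj₂ (proj₂ regular))))) _ _

  pred-core : ∀ {i j} → IsPred _≼_ A j i → IsCore _≼_ (A i) (A j)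
  pred-core = proj₁ (proj₂ (proj₂ (proj₂ (proj₂ (proj₂ (proj₂ regular)))))) _ _

  interpolation : ∀ i j x y → x ∈ A i → y ∈ A j → _≺_ _≼_ x y →
    (toℕ j < toℕ i → Σ (Fin n) λ k → IsSucc _≼_ A i k ×
       Σ (Fin m) λ z → z ∈ A k × _≺_ _≼_ x z × z ≼ y)
    × (toℕ i ≤ toℕ j → Σ (Fin n) λ k → IsPred _≼_ A j k ×
       Σ (Fin m) λ z → z ∈ A k × x ≼ z × _≺_ _≼_ z y)
  interpolation = proj₂ (proj₂ (proj₂ (proj₂ (proj₂ (proj₂ (proj₂ regular))))))

  ⊏⇒disjoint : ∀ {i j x} → _⊏_ _≼_ (A i) (A j) → x ∈ A i → x ∈ A j → ⊥
  ⊏⇒disjoint (_ , Ai≢Aj) = disjoint (Ai≢Aj ∘ cong A)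

  distinct : ∀ {i j x} → i ≢ j → x ∈ A j → A i ≢ A j
  distinct i≢j x∈Aj Ai≡Aj = disjoint i≢j (subst (_ ∈_) (sym Ai≡Aj) x∈Aj) x∈Aj

  ⊏⇒toℕ≢ : ∀ {i j} → _⊏_ _≼_ (A i) (A j) → toℕ i ≢ toℕ j
  ⊏⇒toℕ≢ (_ , Ai≢Aj) = Ai≢Aj ∘ cong A ∘ toℕ-injective

  linked-core : ∀ {i j x y} → IsCore _≼_ (A i) (A j) → x ∈ A i → y ∈ A j → x ≼ y →
    Linked (A i) (A j) w x y
  linked-core {i} core x∈Ai y∈Aj x≼y =
    subst (λ k → Linked _ _ k _ _) (size i) (core⇒linked core x∈Ai y∈Aj x≼y)

  data Descent (i j : Fin n) (x y : Fin m) : Set where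
    via-succ : ∀ {k z} → toℕ j < toℕ i → IsSucc _≼_ A i k → z ∈ A k → x ≼ z → z ≼ y → Descent i j x y
    via-pred : ∀ {k z} → toℕ i ≤ toℕ j → IsPred _≼_ A j k → z ∈ A k → x ≼ z → z ≼ y → Descent i j x y

  descent : ∀ {i j x y} → x ∈ A i → y ∈ A j → x ≼ y → x ≢ y → Descent i j x y
  descent {i} {j} {x} {y} x∈Ai y∈Aj x≼y x≢y with toℕ j <? toℕ i
  ... | yes j<i with proj₁ (interpolation i j x y x∈Ai y∈Aj (x≼y , x≢y)) j<i
  ...   | _ , isSucc , _ , z∈Ak , (x≼z , _) , z≼y = via-succ j<i isSucc z∈Ak x≼z z≼y
  descent {i} {j} {x} {y} x∈Ai y∈Aj x≼y x≢y | no j≮i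
    with proj₂ (interpolation i j x y x∈Ai y∈Aj (x≼y , x≢y)) (≮⇒≥ j≮i)
  ...   | _ , isPred , _ , z∈Ak , x≼z , (z≼y , _) = via-pred (≮⇒≥ j≮i) isPred z∈Ak x≼z z≼y

  linked : ∀ {i j} → Acc _<_ (toℕ i + toℕ j) → _⊏_ _≼_ (A i) (A j) →
    ∀ x y → x ∈ A i → y ∈ A j → x ≼ y → Linked (A i) (A j) w x y
  linked {i} {j} (acc smaller) Ai⊏Aj x y x∈Ai y∈Aj x≼y with x ≟ y
  ... | yes refl = ⊥-elim (⊏⇒disjoint Ai⊏Aj x∈Ai y∈Aj)
  ... | no x≢y with descent x∈Ai y∈Aj x≼y x≢y
  ...   | via-succ {k} j<i isSucc@(k<i , (Ai⊑Ak , _) , least) z∈Ak x≼z z≼y with k ≟ j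
  ...     | yes refl = linked-core (succ-core isSucc) x∈Ai y∈Aj x≼y
  ...     | no k≢j = linked-trans (antichain k) (antichain j) (size k) (size j) Ai⊑Ak Ak⊑Aj
                (λ _ → ⊏⇒disjoint Ai⊏Aj) x∈Ai z∈Ak y∈Aj
                (linked-core (succ-core isSucc) x∈Ai z∈Ak x≼z)
                (linked (smaller (+-monoˡ-< (toℕ j) k<i)) (Ak⊑Aj , distinct k≢j y∈Aj) _ _ z∈Ak y∈Aj z≼y)
    where
    Ak⊑Aj : _⊑_ _≼_ (A k) (A j)
    Ak⊑Aj = least j j<i Ai⊏Aj
  linked {i} {j} (acc smaller) Ai⊏Aj x y x∈Ai y∈Aj x≼y
    | no x≢y | via-pred {k} i≤j isPred@(k<j , (Ak⊑Aj , _) , greatest) z∈Ak x≼z z≼y with i ≟ k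
  ...     | yes refl = linked-core (pred-core isPred) x∈Ai y∈Aj x≼y
  ...     | no i≢k = linked-trans (antichain k) (antichain j) (size k) (size j) Ai⊑Ak Ak⊑Aj
                (λ _ → ⊏⇒disjoint Ai⊏Aj) x∈Ai z∈Ak y∈Aj
                (linked (smaller (+-monoʳ-< (toℕ i) k<j)) (Ai⊑Ak , distinct i≢k z∈Ak) _ _ x∈Ai z∈Ak x≼z)
                (linked-core (pred-core isPred) z∈Ak y∈Aj z≼y)
    where
    Ai⊑Ak : _⊑_ _≼_ (A i) (A k)
    Ai⊑Ak = greatest i (≤∧≢⇒< i≤j (⊏⇒toℕ≢ Ai⊏Aj)) Ai⊏Aj

  core : ∀ {i j} → _⊏_ _≼_ (A i) (A j) → IsCore _≼_ (A i) (A j)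
  core {i} {j} Ai⊏Aj =
    antichain i , antichain j , (λ _ → ⊏⇒disjoint Ai⊏Aj) , Ai⊏Aj , trans (size i) (sym (size j)) ,
    λ x y x∈Ai y∈Aj x≼y → subst (λ k → Linked _ _ k x y) (sym (size i))
                            (linked (<-wellFounded _) Ai⊏Aj x y x∈Ai y∈Aj x≼y)

  Extremal : Fin n → Fin n → Fin n → Set
  Extremal i j t = (∀ k → _⊑_ _≼_ (A t) (A k) → _⊑_ _≼_ (A k) (A j) → toℕ t ≤ toℕ k)
                 ⊎ (∀ k → _⊑_ _≼_ (A i) (A k) → _⊑_ _≼_ (A k) (A t) → toℕ t ≤ toℕ k)

  extremal⇒≤⊔ : ∀ {i j t} → Extremal i j t → _⊑_ _≼_ (A i) (A t) → _⊑_ _≼_ (A t) (A j) →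
    toℕ t ≤ toℕ i ⊔ toℕ j
  extremal⇒≤⊔ {i} {j} (inj₁ least) _     At⊑Aj = m≤n⇒m≤o⊔n (toℕ i) (least j At⊑Aj ⊑-refl)
  extremal⇒≤⊔ {i} {j} (inj₂ least) Ai⊑At _     = m≤n⇒m≤n⊔o (toℕ j) (least i ⊑-refl Ai⊑At)

  extremal-shrinkˡ : ∀ {i j k t} → _⊑_ _≼_ (A i) (A k) → Extremal i j t → Extremal k j t
  extremal-shrinkˡ Ai⊑Ak (inj₁ least) = inj₁ least
  extremal-shrinkˡ Ai⊑Ak (inj₂ least) = inj₂ λ k′ Ak⊑Ak′ → least k′ (⊑-trans Ai⊑Ak Ak⊑Ak′)

  extremal-shrinkʳ : ∀ {i j k t} → _⊑_ _≼_ (A k) (A j) → Extremal i j t → Extremal i k t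
  extremal-shrinkʳ Ak⊑Aj (inj₁ least) = inj₁ λ k′ At⊑Ak′ Ak′⊑Ak → least k′ At⊑Ak′ (⊑-trans Ak′⊑Ak Ak⊑Aj)
  extremal-shrinkʳ Ak⊑Aj (inj₂ least) = inj₂ least

  between : ∀ {i j} → Acc _<_ (toℕ i + toℕ j) →
    ∀ t → _⊑_ _≼_ (A i) (A t) → _⊑_ _≼_ (A t) (A j) → Extremal i j t →
    ∀ x y → x ∈ A i → y ∈ A j → x ≼ y → ∃ λ z → z ∈ A t × x ≼ z × z ≼ y
  between {i} {j} (acc smaller) t Ai⊑At At⊑Aj extremal x y x∈Ai y∈Aj x≼y
    with x ∈? A t | y ∈? A t | x ≟ y
  ... | yes x∈At | _        | _        = x , x∈At , ≼-refl , x≼y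
  ... | no _     | yes y∈At | _        = y , y∈At , x≼y , ≼-refl
  ... | no _     | no _     | yes refl = ⊑-through (antichain j) Ai⊑At At⊑Aj x∈Ai y∈Aj
  ... | no x∉At  | no y∉At  | no x≢y   with descent x∈Ai y∈Aj x≼y x≢y
  ...   | via-succ {k} j<i (k<i , (Ai⊑Ak , _) , least) z∈Ak x≼z z≼y
        with between (smaller (+-monoˡ-< (toℕ j) k<i)) t (least t t<i (Ai⊑At , Ai≢At))
               At⊑Aj (extremal-shrinkˡ Ai⊑Ak extremal) _ _ z∈Ak y∈Aj z≼y
    where
    Ai≢At : A i ≢ A t
    Ai≢At Ai≡At = x∉At (subst (x ∈_) Ai≡At x∈Ai)
    t<i : toℕ t < toℕ i
    t<i = ≤∧≢⇒< (subst (toℕ t ≤_) (m≥n⇒m⊔n≡m (<⇒≤ j<i)) (extremal⇒≤⊔ extremal Ai⊑At At⊑Aj))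
                (λ t≡i → Ai≢At (cong A (sym (toℕ-injective t≡i))))
  ...     | z′ , z′∈At , z≼z′ , z′≼y = z′ , z′∈At , ≼-trans x≼z z≼z′ , z′≼y
  between {i} {j} (acc smaller) t Ai⊑At At⊑Aj extremal x y x∈Ai y∈Aj x≼y
    | no x∉At | no y∉At | no x≢y | via-pred {k} i≤j (k<j , (Ak⊑Aj , _) , greatest) z∈Ak x≼z z≼y
        with between (smaller (+-monoʳ-< (toℕ i) k<j)) t Ai⊑At (greatest t t<j (At⊑Aj , At≢Aj))
               (extremal-shrinkʳ Ak⊑Aj extremal) _ _ x∈Ai z∈Ak x≼z
    where
    At≢Aj : A t ≢ A j
    At≢Aj At≡Aj = y∉At (subst (y ∈_) (sym At≡Aj) y∈Aj)
    t<j : toℕ t < toℕ j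
    t<j = ≤∧≢⇒< (subst (toℕ t ≤_) (m≤n⇒m⊔n≡n i≤j) (extremal⇒≤⊔ extremal Ai⊑At At⊑Aj))
                (At≢Aj ∘ cong A ∘ toℕ-injective)
  ...     | z′ , z′∈At , x≼z′ , z′≼z = z′ , z′∈At , x≼z′ , ≼-trans z′≼z z≼y

proposition4p1 : {m n w : ℕ} (_≼_ : Rel (Fin m) 0ℓ) → IsPartialOrder _≡_ _≼_ →
    (A : Fin n → Subset m) → IsRegular _≼_ A w →
    (r s : Fin n) → _⊏_ _≼_ (A r) (A s) →
    IsCore _≼_ (A r) (A s)
    × ((t : Fin n) → _⊑_ _≼_ (A r) (A t) → _⊑_ _≼_ (A t) (A s) →
         ((∀ k → _⊑_ _≼_ (A t) (A k) → _⊑_ _≼_ (A k) (A s) → toℕ t ≤ toℕ k)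
          ⊎ (∀ k → _⊑_ _≼_ (A r) (A k) → _⊑_ _≼_ (A k) (A t) → toℕ t ≤ toℕ k)) →
         ∀ x y → x ∈ A r → y ∈ A s → x ≼ y →
         Σ (Fin m) λ z → z ∈ A t × (x ≼ z) × (z ≼ y))
proposition4p1 _≼_ ≼-isPartialOrder A regular r s Ar⊏As = core Ar⊏As , between (<-wellFounded _)
  where open RegularPoset (IsPartialOrder.isPreorder ≼-isPartialOrder) regular
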